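{- If $H$ is a disconnected or bipartite graph on $k$ vertices, then the largest connected component of $H^{\otimes t}$ has size $O((k-1)^t)$ (as $t\to\infty$).
   Context: $H^{\otimes t}$ is the graph on $V(H)^t$ whose adjacency matrix is the $t$-fold Kronecker (tensor) product of the adjacency matrix of $H$ with itself; i.e., $(u_1,\dots,u_t)$ and $(v_1,\dots,v_t)$ are adjacent iff $u_i$ is adjacent to $v_i$ in $H$ for every $i$. -}

module Defs where

open import Level using (0ℓ)
open import Data.Nat using (ℕ; _≤_; _*_; _∸_; _^_)
open import Data.Fin using (Fin)
open import Data.Bool using (Bool)
open import Data.Product using (Σ; ∃; ∃-syntax; _×_)
open import Data.Vec using (Vec)
open import Data.List using (List; length)
open import Data.List.Relation.Unary.All using (All)
open import Data.List.Relation.Unary.Unique.Propositional using (Unique)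
open import Data.Vec.Relation.Binary.Pointwise.Inductive using (Pointwise)
open import Relation.Binary.Construct.Closure.ReflexiveTransitive using (Star)
open import Relation.Binary.PropositionalEquality using (_≡_)
open import Relation.Nullary using (¬_)

record Graph (k : ℕ) : Set₁ where
  field
    Adj    : Fin k → Fin k → Set
    sym    : ∀ {u v} → Adj u v → Adj v u
    irrefl : ∀ {u} → ¬ Adj u u
open Graph public

Connected : ∀ {k} → Graph k → Fin k → Fin k → Set
Connected H = Star (Adj H)

Disconnected : ∀ {k} → Graph k → Set
Disconnected H = ∃[ u ] ∃[ v ] ¬ Connected H u v

Bipartite : ∀ {k} → Graph k → Set
Bipartite {k} H = Σ (Fin k → Bool) λ c → ∀ {u v} → Adj H u v → ¬ (c u ≡ c v)

TensorAdj : ∀ {k} → Graph k → (t : ℕ) → Vec (Fin k) t → Vec (Fin k) t → Set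
TensorAdj H t = Pointwise (Adj H)

TensorConnected : ∀ {k} → Graph k → (t : ℕ) → Vec (Fin k) t → Vec (Fin k) t → Set
TensorConnected H t = Star (TensorAdj H t)

-- Every connected component of H^{⊗t} has at most n vertices:
-- any duplicate-free list of vertices in the component of v has length ≤ n.
ComponentsBoundedBy : ∀ {k} → Graph k → (t : ℕ) → ℕ → Set
ComponentsBoundedBy {k} H t n =
  (v : Vec (Fin k) t) (ws : List (Vec (Fin k) t)) →
  Unique ws → All (TensorConnected H t v) ws → length ws ≤ n

-- For each vertex v of H^{⊗t} there are at most two vectors x, depending only on v, such that
-- every w in the component of v satisfies wᵢ ≠ xᵢ for all i with one of them; and exactly
-- (k-1)^t vectors avoid a given x in this sense.  If a and b lie in different components of H,
-- take each xᵢ ∈ {a, b} outside the component of vᵢ: a walk from v to w projects to walks from vᵢ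
-- to wᵢ, so wᵢ ≠ xᵢ.  If H is properly 2-coloured, every step in H^{⊗t} flips the colour of all
-- coordinates at once, so the colours of w are those of v either all kept or all flipped; for each
-- of the two cases take xᵢ of the colour wᵢ cannot have.  A bipartite graph using only one colour
-- has no edges, so it is disconnected.
module Submission where

open import Defs
open import Data.Nat using (ℕ; suc; pred; _+_; _≤_; _*_; _∸_; _^_; z≤n; s≤s)
open import Data.Product using (Σ; Σ-syntax; ∃; ∃-syntax; _,_; proj₁; proj₂)
open import Data.Sum using (_⊎_; inj₁; inj₂)
import Data.Sum as Sum
open import Data.Bool using (Bool; true; false; not; _xor_)
open import Data.Bool.Properties using (¬-not; not-distribˡ-xor; not-distribʳ-xor; xor-identityʳ)
  renaming (_≟_ to _≟ᵇ_)
open import Data.Fin using (Fin; zero; suc)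
open import Data.Fin.Properties using (all?; ¬∀⟶∃¬)
open import Data.List using (List; []; _∷_; [_]; length; _++_; map; allFin; cartesianProductWith)
open import Data.List.Properties using (length-++; length-map; length-removeAt; length-removeAt′; length-tabulate)
open import Data.List.Membership.Propositional using (_∈_)
open import Data.List.Membership.Propositional.Properties
  using (∈-allFin; ∈-++⁺ˡ; ∈-++⁺ʳ; ∈-cartesianProductWith⁺)
open import Data.List.Relation.Binary.Subset.Propositional using (_⊆_)
import Data.List.Relation.Unary.All as All
open import Data.List.Relation.Unary.AllPairs using (_∷_)
open import Data.List.Relation.Unary.Any using (here; there; index; _─_)
open import Data.List.Relation.Unary.Unique.Propositional using (Unique)
open import Data.Nat.Properties using (_≤?_; module ≤-Reasoning)
open import Data.Vec using (Vec; []; _∷_)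
import Data.Vec as Vec
open import Data.Vec.Relation.Binary.Pointwise.Inductive using (Pointwise; []; _∷_)
import Data.Vec.Relation.Binary.Pointwise.Inductive as Pointwise
import Data.Vec.Relation.Unary.Any as VecAny
open import Function using (_∘_; id)
open import Relation.Binary.Construct.Closure.ReflexiveTransitive using (Star; ε; _◅_; _◅◅_; reverse)
open import Relation.Binary.PropositionalEquality using (_≡_; _≢_; refl; cong; cong₂; subst; module ≡-Reasoning)
import Relation.Binary.PropositionalEquality as ≡
open import Relation.Nullary using (¬_; yes; no)
open import Relation.Nullary.Decidable using (decidable-stable)
open import Relation.Nullary.Negation using (contradiction; ¬¬-map)

module _ {A : Set} where

  ∈-─⁺ : ∀ {w y : A} {xs} (w∈xs : w ∈ xs) → y ∈ xs → y ≢ w → y ∈ (xs ─ w∈xs)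
  ∈-─⁺ (here refl)  (here refl)  y≢w = contradiction refl y≢w
  ∈-─⁺ (here refl)  (there y∈xs) _   = y∈xs
  ∈-─⁺ (there _)    (here y≡x)   _   = here y≡x
  ∈-─⁺ (there w∈xs) (there y∈xs) y≢w = there (∈-─⁺ w∈xs y∈xs y≢w)

  Unique⇒length-≤ : ∀ {xs ys : List A} → Unique xs → xs ⊆ ys → length xs ≤ length ys
  Unique⇒length-≤ {[]}     _               _     = z≤n
  Unique⇒length-≤ {w ∷ xs} {ys} (w∉xs ∷ unique) xs⊆ys = begin
    suc (length xs)          ≤⟨ s≤s (Unique⇒length-≤ unique xs⊆ys─w) ⟩
    suc (length (ys ─ w∈ys)) ≡⟨ length-removeAt′ ys (index w∈ys) ⟨
    length ys                ∎
    where
    open ≤-Reasoning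
    w∈ys : w ∈ ys
    w∈ys = xs⊆ys (here refl)
    xs⊆ys─w : xs ⊆ (ys ─ w∈ys)
    xs⊆ys─w y∈xs = ∈-─⁺ w∈ys (xs⊆ys (there y∈xs)) (All.lookup w∉xs y∈xs ∘ ≡.sym)

length-cartesianProductWith : ∀ {A B C : Set} (f : A → B → C) xs ys →
  length (cartesianProductWith f xs ys) ≡ length xs * length ys
length-cartesianProductWith f []       ys = refl
length-cartesianProductWith f (x ∷ xs) ys = begin
  length (map (f x) ys ++ cartesianProductWith f xs ys)          ≡⟨ length-++ (map (f x) ys) ⟩
  length (map (f x) ys) + length (cartesianProductWith f xs ys)  ≡⟨ cong₂ _+_ (length-map (f x) ys)
                                                                      (length-cartesianProductWith f xs ys) ⟩
  length ys + length xs * length ys                              ∎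
  where open ≡-Reasoning

Avoids : ∀ {A : Set} {t} → Vec A t → Vec A t → Set
Avoids = Pointwise _≢_

module _ {n : ℕ} where

  avoiding : ∀ {t} → Vec (Fin (suc n)) t → List (Vec (Fin (suc n)) t)
  avoiding []       = [ [] ]
  avoiding (x ∷ xs) = cartesianProductWith _∷_ (allFin (suc n) ─ ∈-allFin x) (avoiding xs)

  length-avoiding : ∀ {t} (x : Vec (Fin (suc n)) t) → length (avoiding x) ≡ n ^ t
  length-avoiding []       = refl
  length-avoiding {suc t} (x ∷ xs) = begin
    length (cartesianProductWith _∷_ others (avoiding xs)) ≡⟨ length-cartesianProductWith _∷_ others (avoiding xs) ⟩
    length others * length (avoiding xs)                   ≡⟨ cong₂ _*_ length-others (length-avoiding xs) ⟩
    n * n ^ t                                              ∎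
    where
    open ≡-Reasoning
    others : List (Fin (suc n))
    others = allFin (suc n) ─ ∈-allFin x
    length-others : length others ≡ n
    length-others = ≡.trans (length-removeAt (allFin (suc n)) (index (∈-allFin x))) (cong pred (length-tabulate {n = suc n} id))

  ∈-avoiding : ∀ {t} {w x : Vec (Fin (suc n)) t} → Avoids w x → w ∈ avoiding x
  ∈-avoiding [] = here refl
  ∈-avoiding {w = wᵢ ∷ _} {x = xᵢ ∷ _} (wᵢ≢xᵢ ∷ w≉x) =
    ∈-cartesianProductWith⁺ _∷_ (∈-─⁺ (∈-allFin xᵢ) (∈-allFin wᵢ) wᵢ≢xᵢ) (∈-avoiding w≉x)

  boxes : ∀ {t c} → Vec (Vec (Fin (suc n)) t) c → List (Vec (Fin (suc n)) t)
  boxes []       = []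
  boxes (x ∷ xs) = avoiding x ++ boxes xs

  length-boxes : ∀ {t c} (xs : Vec (Vec (Fin (suc n)) t) c) → length (boxes xs) ≡ c * n ^ t
  length-boxes []       = refl
  length-boxes (x ∷ xs) = ≡.trans (length-++ (avoiding x)) (cong₂ _+_ (length-avoiding x) (length-boxes xs))

  ∈-boxes : ∀ {t c} {w} {xs : Vec (Vec (Fin (suc n)) t) c} → VecAny.Any (Avoids w) xs → w ∈ boxes xs
  ∈-boxes (VecAny.here w≉x) = ∈-++⁺ˡ (∈-avoiding w≉x)
  ∈-boxes {xs = x ∷ _} (VecAny.there w∈) = ∈-++⁺ʳ (avoiding x) (∈-boxes w∈)

CoveredBy : ∀ {k c} (H : Graph k) (t : ℕ) → Vec (Fin k) t → Vec (Vec (Fin k) t) c → Set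
CoveredBy H t v xs = ∀ {w} → TensorConnected H t v w → VecAny.Any (Avoids w) xs

Covering : ∀ {k} (H : Graph k) (t : ℕ) → Vec (Fin k) t → ℕ → Set
Covering {k} H t v c = Σ (Vec (Vec (Fin k) t) c) (CoveredBy H t v)

¬¬Covering⇒componentsBoundedBy : ∀ {n c} (H : Graph (suc n)) (t : ℕ) →
  (∀ v → ¬ ¬ Covering H t v c) → ComponentsBoundedBy H t (c * n ^ t)
¬¬Covering⇒componentsBoundedBy {n} {c} H t coverable v ws unique connected =
  decidable-stable (length ws ≤? c * n ^ t) (¬¬-map bound (coverable v))
  where
  bound : Covering H t v c → length ws ≤ c * n ^ t
  bound (xs , covered) = subst (length ws ≤_) (length-boxes xs)
    (Unique⇒length-≤ unique (∈-boxes ∘ covered ∘ All.lookup connected))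

¬¬-pointwise-choice : ∀ {A B : Set} {R : A → B → Set} → (∀ a → ¬ ¬ ∃ (R a)) →
  ∀ {t} (v : Vec A t) → ¬ ¬ (Σ (Vec B t) (Pointwise R v))
¬¬-pointwise-choice choose []      ¬choice = ¬choice ([] , [])
¬¬-pointwise-choice choose (a ∷ v) ¬choice =
  choose a λ (b , r) → ¬¬-pointwise-choice choose v λ (x , rs) → ¬choice (b ∷ x , r ∷ rs)

avoids : ∀ {A : Set} {R : A → A → Set} {t} {v w x : Vec A t} →
  Pointwise R v w → Pointwise (λ a b → ¬ R a b) v x → Avoids w x
avoids []       []         = []
avoids (r ∷ rs) (¬r ∷ ¬rs) = (λ { refl → ¬r r }) ∷ avoids rs ¬rs

Star-Pointwise⇒Pointwise-Star : ∀ {A : Set} {R : A → A → Set} {t} {v w : Vec A t} →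
  Star (Pointwise R) v w → Pointwise (Star R) v w
Star-Pointwise⇒Pointwise-Star ε          = Pointwise.refl ε
Star-Pointwise⇒Pointwise-Star (rs ◅ rss) = Pointwise.trans _◅_ rs (Star-Pointwise⇒Pointwise-Star rss)

-- Connectivity in H need not be decidable, so the centre is only found under double negation.
disconnected⇒¬¬Covering : ∀ {k} (H : Graph k) → Disconnected H →
  ∀ {t} (v : Vec (Fin k) t) → ¬ ¬ Covering H t v 1
disconnected⇒¬¬Covering {k} H (a , b , a≁b) {t} v = ¬¬-map cover (¬¬-pointwise-choice unreachable v)
  where
  unreachable : ∀ p → ¬ ¬ (∃[ q ] ¬ Connected H p q)
  unreachable p ¬h = ¬h (a , λ p~a → ¬h (b , λ p~b → a≁b (reverse (sym H) p~a ◅◅ p~b)))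
  cover : Σ (Vec (Fin k) t) (Pointwise (λ p q → ¬ Connected H p q) v) → Covering H t v 1
  cover (x , apart) = x ∷ [] , λ v~w → VecAny.here (avoids (Star-Pointwise⇒Pointwise-Star v~w) apart)

ColourOffset : ∀ {k} → (Fin k → Bool) → Bool → Fin k → Fin k → Set
ColourOffset c b p q = c q ≡ c p xor b

module _ {k} (H : Graph k) {c : Fin k → Bool} (proper : ∀ {u v} → Adj H u v → ¬ c u ≡ c v) where

  edge-flips-offset : ∀ b {p q r} → Adj H p q → ColourOffset c b q r → ColourOffset c (not b) p r
  edge-flips-offset b {p} {q} {r} p~q offset = begin
    c r             ≡⟨ offset ⟩
    c q xor b       ≡⟨ cong (_xor b) (¬-not (proper p~q ∘ ≡.sym)) ⟩
    not (c p) xor b ≡⟨ not-distribˡ-xor (c p) b ⟨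
    not (c p xor b) ≡⟨ not-distribʳ-xor (c p) b ⟩
    c p xor not b   ∎
    where open ≡-Reasoning

  tensorConnected⇒colourOffset : ∀ {t} {v w : Vec (Fin k) t} →
    TensorConnected H t v w → ∃[ b ] Pointwise (ColourOffset c b) v w
  tensorConnected⇒colourOffset ε = false , Pointwise.refl (≡.sym (xor-identityʳ _))
  tensorConnected⇒colourOffset (v~u ◅ u~w) =
    let b , offset = tensorConnected⇒colourOffset u~w
    in not b , Pointwise.trans (edge-flips-offset b) v~u offset

  nontrivialBipartition⇒Covering : (∀ β → ∃[ q ] c q ≢ β) →
    ∀ {t} (v : Vec (Fin k) t) → Covering H t v 2
  nontrivialBipartition⇒Covering misses {t} v = centre false v ∷ centre true v ∷ [] , cover
    where
    centre : Bool → ∀ {s} → Vec (Fin k) s → Vec (Fin k) s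
    centre b = Vec.map (λ p → proj₁ (misses (c p xor b)))
    apart : ∀ b {s} (u : Vec (Fin k) s) → Pointwise (λ p q → ¬ ColourOffset c b p q) u (centre b u)
    apart b []      = []
    apart b (p ∷ u) = proj₂ (misses (c p xor b)) ∷ apart b u
    cover : CoveredBy H t v (centre false v ∷ centre true v ∷ [])
    cover v~w with tensorConnected⇒colourOffset v~w
    ... | false , offset = VecAny.here (avoids offset (apart false v))
    ... | true  , offset = VecAny.there (VecAny.here (avoids offset (apart true v)))

distinct-values⇒misses-each : ∀ {A : Set} {f : A → Bool} {a b} → f a ≢ f b → ∀ β → ∃[ x ] f x ≢ β
distinct-values⇒misses-each {f = f} {a} {b} fa≢fb β with f a ≟ᵇ β
... | yes refl = b , fa≢fb ∘ ≡.sym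
... | no fa≢β  = a , fa≢β

NontrivialBipartition : ∀ {k} → Graph k → Set
NontrivialBipartition H = Σ[ bipartite ∈ Bipartite H ] ∀ β → ∃[ q ] proj₁ bipartite q ≢ β

bipartite⇒disconnected⊎nontrivial : ∀ {m} (H : Graph (suc (suc m))) →
  Bipartite H → Disconnected H ⊎ NontrivialBipartition H
bipartite⇒disconnected⊎nontrivial H (c , proper) with all? (λ p → c p ≟ᵇ c zero)
... | yes monochromatic =
  inj₁ (zero , suc zero , λ { (p~q ◅ _) → proper p~q (≡.trans (monochromatic _) (≡.sym (monochromatic _))) })
... | no ¬monochromatic =
  inj₂ ((c , proper) , distinct-values⇒misses-each (proj₂ (¬∀⟶∃¬ _ _ (λ p → c p ≟ᵇ c zero) ¬monochromatic)))

lemma11 : (k : ℕ) → 2 ≤ k → (H : Graph k) → Disconnected H ⊎ Bipartite H →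
    ∃[ C ] ∃[ t₀ ] ((t : ℕ) → t₀ ≤ t → ComponentsBoundedBy H t (C * (k ∸ 1) ^ t))
lemma11 _ (s≤s (s≤s z≤n)) H disconnected⊎bipartite
  with Sum.[ inj₁ , bipartite⇒disconnected⊎nontrivial H ]′ disconnected⊎bipartite
... | inj₁ disconnected = 1 , 0 , λ t _ →
  ¬¬Covering⇒componentsBoundedBy H t (disconnected⇒¬¬Covering H disconnected)
... | inj₂ ((_ , proper) , misses) = 2 , 0 , λ t _ →
  ¬¬Covering⇒componentsBoundedBy H t (contradiction ∘ nontrivialBipartition⇒Covering H proper misses)
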